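{- Let $D$ be a minimal counterexample to the conjecture described in the context, and $C$ its Hamilton cycle as described there. For any vertex $x$ with successor $x^+$ on $C$, no vertex $y$ of $D$ monochromatically dominates $x$ in a colour in which $y$ is monochromatically dominated by $x^+$.
   Context: A 3-coloured tournament is a finite tournament each of whose edges is coloured red, blue or green. A triple of vertices spans a $T_3$ if the three edges between them form a directed cycle with three distinct colours. For distinct vertices $x,y$, $x$ monochromatically dominates $y$ in colour $c$ if there is a directed path from $x$ to $y$ all of whose edges have colour $c$. The conjecture: every 3-coloured tournament has a triple spanning a $T_3$ or a vertex monochromatically dominating every other vertex. A minimal counterexample is a 3-coloured tournament $D$ with no $T_3$ and no vertex dominating all others, such that every proper nonempty subtournament has a $T_3$ or a vertex monochromatically dominating all its other vertices within it. Such $D$ has a unique directed Hamilton cycle $C$ such that each vertex monochromatically dominates every vertex except its predecessor on $C$; $x^+$ and $x^-$ denote the successor and predecessor of $x$ on $C$. -}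

module Defs where

open import Data.Nat using (ℕ)
open import Data.Fin using (Fin)
open import Data.Fin.Subset using (Subset; _∈_; _∉_; ⊤)
open import Data.Product using (Σ; ∃; _×_; ∃-syntax)
open import Data.Sum using (_⊎_)
open import Data.Empty using (⊥)
open import Relation.Nullary using (¬_)
open import Relation.Binary.PropositionalEquality using (_≡_; _≢_)
open import Data.Nat using (zero; suc)

data Colour : Set where
  red blue green : Colour

-- A 3-coloured tournament on the vertex set Fin n.
-- arc x y : there is an edge directed from x to y.
-- colour x y : the colour of the edge between x and y (only meaningful when arc x y).
record Tournament3 (n : ℕ) : Set₁ where
  field
    arc     : Fin n → Fin n → Set
    colour  : Fin n → Fin n → Colour
    irrefl  : ∀ x → ¬ arc x x
    total   : ∀ x y → x ≢ y → arc x y ⊎ arc y x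
    asym    : ∀ x y → arc x y → ¬ arc y x

module _ {n : ℕ} (D : Tournament3 n) where
  open Tournament3 D

  -- Directed walk from x to y, of length ≥ 1, all edges of colour c,
  -- all vertices inside S.  (A walk exists iff a path exists.)
  data MonoPath (S : Subset n) (c : Colour) : Fin n → Fin n → Set where
    edge : ∀ {x y} → x ∈ S → y ∈ S → arc x y → colour x y ≡ c → MonoPath S c x y
    step : ∀ {x z y} → x ∈ S → arc x z → colour x z ≡ c → MonoPath S c z y → MonoPath S c x y

  MonoDom : Subset n → Colour → Fin n → Fin n → Set
  MonoDom S c x y = x ≢ y × MonoPath S c x y

  HasT3 : Subset n → Set
  HasT3 S = ∃[ x ] ∃[ y ] ∃[ z ]
    (x ∈ S × y ∈ S × z ∈ S × arc x y × arc y z × arc z x ×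
     colour x y ≢ colour y z × colour y z ≢ colour z x × colour z x ≢ colour x y)

  HasDominator : Subset n → Set
  HasDominator S = ∃[ x ] (x ∈ S × (∀ y → y ∈ S → x ≢ y → ∃[ c ] MonoDom S c x y))

  ProperNonempty : Subset n → Set
  ProperNonempty S = (∃[ x ] x ∈ S) × (∃[ x ] x ∉ S)

  MinimalCounterexample : Set
  MinimalCounterexample =
    ¬ HasT3 ⊤ × ¬ HasDominator ⊤ ×
    (∀ S → ProperNonempty S → HasT3 S ⊎ HasDominator S)

  iter : (Fin n → Fin n) → ℕ → Fin n → Fin n
  iter s zero x = x
  iter s (suc k) x = s (iter s k x)

  IsHamiltonCycle : (Fin n → Fin n) → Set
  IsHamiltonCycle s = (∀ x → arc x (s x)) × (∀ x y → ∃[ k ] iter s k x ≡ y)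

  DominatesAllButPred : (Fin n → Fin n) → Set
  DominatesAllButPred s = ∀ x y → x ≢ y → s y ≢ x → ∃[ c ] MonoDom ⊤ c x y

module Submission where

-- Let x⁺ = s x be the successor of x on the Hamilton cycle.
-- By hypothesis x⁺ monochromatically dominates every vertex except itself
-- and its predecessor on the cycle.  That predecessor is x, because the
-- successor map of a Hamilton cycle is onto, and an onto self-map of the
-- finite set Fin n is one-to-one.  Now if some y satisfied x⁺ ⇒c y ⇒c x
-- (monochromatic paths of one colour c), then by concatenating the two
-- paths x⁺ would dominate x as well, hence every other vertex,
-- contradicting that D is a counterexample.

open import Defs
open import Data.Nat using (ℕ; zero; suc)
open import Data.Nat.Properties using (1+n≰n)
open import Data.Fin using (Fin; _≟_; punchOut)
open import Data.Fin.Properties using (injective⇒≤; punchOut-injective)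
open import Data.Fin.Subset using (Subset; ⊤)
open import Data.Fin.Subset.Properties using (∈⊤)
open import Data.Product using (_×_; ∃-syntax; _,_; proj₁; proj₂)
open import Data.Sum using (_⊎_; inj₁; inj₂)
open import Data.Empty using (⊥-elim)
open import Relation.Nullary using (¬_; yes; no)
open import Relation.Binary.PropositionalEquality
  using (_≡_; _≢_; refl; sym; trans; cong; subst)

monoPath-trans : ∀ {n} (D : Tournament3 n) {S : Subset n} {c : Colour} {x y z : Fin n} →
  MonoPath D S c x y → MonoPath D S c y z → MonoPath D S c x z
monoPath-trans D (edge x∈S _ a col) q = step x∈S a col q
monoPath-trans D (step x∈S a col p) q = step x∈S a col (monoPath-trans D p q)

-- An injective map Fin n → Fin n cannot omit a value: removing the omitted
-- value would give an injection Fin (suc m) → Fin m.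
injective-self-map-hits : ∀ {n} (g : Fin n → Fin n) →
  (∀ {a b} → g a ≡ g b → a ≡ b) → (w : Fin n) → ¬ (∀ z → g z ≢ w)
injective-self-map-hits {suc m} g g-inj w misses =
  1+n≰n (injective⇒≤ {f = squeeze} squeeze-inj)
  where
  w≢g : ∀ z → w ≢ g z
  w≢g z w≡gz = misses z (sym w≡gz)

  squeeze : Fin (suc m) → Fin m
  squeeze z = punchOut (w≢g z)

  squeeze-inj : ∀ {a b} → squeeze a ≡ squeeze b → a ≡ b
  squeeze-inj {a} {b} eq = g-inj (punchOut-injective (w≢g a) (w≢g b) eq)

-- Choose a section g of f; g is
-- injective.  If f x ≡ f y with x ≢ y, then g (f x) differs from one of x, y,
-- and that one is omitted by g, which is impossible.
module _ {n} (f : Fin n → Fin n) (onto : ∀ y → ∃[ x ] f x ≡ y) where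

  private
    g : Fin n → Fin n
    g y = proj₁ (onto y)

    g-section : ∀ z → f (g z) ≡ z
    g-section z = proj₂ (onto z)

    g-inj : ∀ {a b} → g a ≡ g b → a ≡ b
    g-inj {a} {b} eq = trans (sym (g-section a)) (trans (cong f eq) (g-section b))

    image-of-section : ∀ {x y} → f x ≡ f y → ∀ z → g z ≡ x ⊎ g z ≡ y → z ≡ f x
    image-of-section fx≡fy z (inj₁ gz≡x) = trans (sym (g-section z)) (cong f gz≡x)
    image-of-section fx≡fy z (inj₂ gz≡y) =
      trans (sym (g-section z)) (trans (cong f gz≡y) (sym fx≡fy))

  surjective⇒injective : ∀ {x y} → f x ≡ f y → x ≡ y
  surjective⇒injective {x} {y} fx≡fy with x ≟ y
  ... | yes x≡y = x≡y
  ... | no x≢y with g (f x) ≟ x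
  ...   | yes gfx≡x = ⊥-elim (injective-self-map-hits g g-inj y λ z gz≡y →
          x≢y (trans (sym gfx≡x)
            (trans (cong g (sym (image-of-section fx≡fy z (inj₂ gz≡y)))) gz≡y)))
  ...   | no gfx≢x = ⊥-elim (injective-self-map-hits g g-inj x λ z gz≡x →
          gfx≢x (subst (λ t → g t ≡ x) (image-of-section fx≡fy z (inj₁ gz≡x)) gz≡x))

module _ {n} (D : Tournament3 n) {s : Fin n → Fin n} (ham : IsHamiltonCycle D s) where
  open Tournament3 D

  successor-≢ : ∀ x → s x ≢ x
  successor-≢ x sx≡x = irrefl x (subst (arc x) sx≡x (proj₁ ham x))

  -- Every vertex y has a predecessor: the walk along the cycle from s y back
  -- to y takes at least one step (as s y ≢ y), and its last step enters y.
  successor-onto : ∀ y → ∃[ x ] s x ≡ y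
  successor-onto y with proj₂ ham (s y) y
  ... | zero  , sy≡y = ⊥-elim (successor-≢ y sy≡y)
  ... | suc k , e    = iter D s k (s y) , e

  predecessor-unique : ∀ {x z} → s z ≡ s x → z ≡ x
  predecessor-unique = surjective⇒injective s successor-onto

-- If y ⇐c x⁺ and x ⇐c y for one colour c, then x⁺ dominates x
-- through y, and dominates every other vertex z ≠ x⁺ by hypothesis, since z
-- is not the predecessor x of x⁺.  So x⁺ dominates all of D, which a
-- counterexample forbids.
mainTheorem4 : (n : ℕ) (D : Tournament3 n) → MinimalCounterexample D →
    (s : Fin n → Fin n) → IsHamiltonCycle D s → DominatesAllButPred D s →
    ∀ (x : Fin n) → ¬ (∃[ y ] ∃[ c ] (MonoDom D ⊤ c y x × MonoDom D ⊤ c (s x) y))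
mainTheorem4 n D (_ , noDominator , _) s ham dominates x (y , c , (_ , y⇒x) , (_ , sx⇒y)) =
  noDominator (s x , ∈⊤ , λ z _ → sx-dominates z)
  where
  sx-dominates : ∀ z → s x ≢ z → ∃[ d ] MonoDom D ⊤ d (s x) z
  sx-dominates z sx≢z with z ≟ x
  ... | yes refl = c , sx≢z , monoPath-trans D sx⇒y y⇒x
  ... | no z≢x   = dominates (s x) z sx≢z (λ sz≡sx → z≢x (predecessor-unique D ham sz≡sx))
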